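{- Let $\Sigma$ and $W$ be disjoint finite sets of propositions, let $a,b$ be propositions of $\Sigma\cup W$, let $l\in\mathbb{N}$, and let $T=\Box^{\mathsf{w}}[b\leftrightarrow\Diamond\!\!\!\!-_{[l,\infty)}a]$. Then one can synthesize a formula $\psi\in\mathsf{MTL}[\mathsf{U}_I]$ built from $\Sigma\cup W$ that is equivalent to $ONF_\Sigma(T)$, i.e. for every $(\Sigma,W)$-oversampled behaviour $\rho'$, $\rho'\models\psi$ iff $\rho'\models ONF_\Sigma(T)$.
   Context: A finite timed word over a finite set $\Delta$ is $\rho=(\sigma,\tau)$ with $\sigma_i\in2^{\Delta}\setminus\{\emptyset\}$ and $\tau_1\le\dots\le\tau_n$ in $\mathbb{R}_{\ge0}$. $\mathsf{MTL}$ formulae use propositions, boolean connectives and $\mathsf{U}_I,\mathsf{S}_I$ ($I$ an interval with endpoints in $\mathbb{N}\cup\{\infty\}$) with the standard strict pointwise semantics; $\rho\models\varphi$ iff $\rho,1\models\varphi$. $\mathsf{MTL}[\mathsf{U}_I]$ is the fragment without $\mathsf{S}_I$. Abbreviations: $\Diamond_I\phi=true\,\mathsf{U}_I\phi$, $\Diamond\!\!\!\!-_I\phi=true\,\mathsf{S}_I\phi$, $\Box_I\phi=\neg\Diamond_I\neg\phi$, $\Box=\Box_{[0,\infty)}$, $\Box^{\mathsf{w}}\phi=\phi\wedge\Box\phi$, $\bot=\neg true$. A $(\Sigma,W)$-oversampled behaviour is a timed word over $\Sigma\cup W$ whose first and last letters intersect $\Sigma$. With $act=\bigvee\Sigma$,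 $ONF_\Sigma(\psi)$ is obtained by recursively replacing each $a\in\Sigma$ by $a\wedge act$, each $\phi_i\mathsf{U}_I\phi_j$ by $(act\rightarrow ONF_\Sigma(\phi_i))\mathsf{U}_I(ONF_\Sigma(\phi_j)\wedge act)$, each $\phi_i\mathsf{S}_I\phi_j$ by $(act\rightarrow ONF_\Sigma(\phi_i))\mathsf{S}_I(ONF_\Sigma(\phi_j)\wedge act)$, each $\Box_I\phi$ by $\Box_I(act\rightarrow ONF_\Sigma(\phi))$, each $\Diamond_I\phi$ by $\Diamond_I(\phi\wedge act)$, and conjoining the result with $act\wedge(\Box\bot\rightarrow act)$.
   Formalization: The timestamps of the $(\Sigma,W)$-oversampled behaviours are nonnegative rationals instead of nonnegative reals. -}

module Defs where

open import Data.Nat as ℕ using (ℕ; zero; suc)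
open import Data.Bool using (Bool; true; false; if_then_else_)
open import Data.Maybe using (Maybe; just; nothing)
open import Data.List using (List; []; _∷_; _++_)
open import Data.List.Membership.Propositional using (_∈_)
open import Data.Integer using (+_)
open import Data.Rational as ℚ using (ℚ; 0ℚ)
open import Data.Product using (Σ; ∃; ∃-syntax; _×_; _,_)
open import Data.Unit using (⊤)
open import Data.Empty using (⊥)
open import Relation.Nullary using (¬_)

-- Propositions are natural numbers; finite sets of propositions are lists.
Prop : Set
Prop = ℕ

ℕtoℚ : ℕ → ℚ
ℕtoℚ n = (+ n) ℚ./ 1

-- Intervals with endpoints in ℕ ∪ {∞} (upper = nothing means ∞)

record Interval : Set where
  constructor interval
  field
    lower       : ℕ
    lowerClosed : Bool
    upper       : Maybe ℕ
    upperClosed : Bool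

open Interval public

_∈I_ : ℚ → Interval → Set
d ∈I I = lowOK (lowerClosed I) × highOK (upper I) (upperClosed I)
  where
  lowOK : Bool → Set
  lowOK true  = ℕtoℚ (lower I) ℚ.≤ d
  lowOK false = ℕtoℚ (lower I) ℚ.< d
  highOK : Maybe ℕ → Bool → Set
  highOK nothing  _     = ⊤
  highOK (just u) true  = d ℚ.≤ ℕtoℚ u
  highOK (just u) false = d ℚ.< ℕtoℚ u

I0∞ : Interval
I0∞ = interval 0 true nothing false

Il∞ : ℕ → Interval
Il∞ l = interval l true nothing false

data Form : Set where
  prop : Prop → Form
  tt   : Form
  ¬'_  : Form → Form
  _∧'_ : Form → Form → Form
  U'   : Interval → Form → Form → Form   -- U' I φ ψ  =  φ U_I ψ
  S'   : Interval → Form → Form → Form   -- S' I φ ψ  =  φ S_I ψ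

ff : Form
ff = ¬' tt

_∨'_ : Form → Form → Form
φ ∨' ψ = ¬' ((¬' φ) ∧' (¬' ψ))

_⇒'_ : Form → Form → Form
φ ⇒' ψ = (¬' φ) ∨' ψ

_⇔'_ : Form → Form → Form
φ ⇔' ψ = (φ ⇒' ψ) ∧' (ψ ⇒' φ)

◇ : Interval → Form → Form
◇ I φ = U' I tt φ

◇⁻ : Interval → Form → Form
◇⁻ I φ = S' I tt φ

□ : Interval → Form → Form
□ I φ = ¬' (◇ I (¬' φ))

□all : Form → Form
□all = □ I0∞

□ʷ : Form → Form
□ʷ φ = φ ∧' □all φ

data FutureOnly : Form → Set where
  fo-prop : ∀ p → FutureOnly (prop p)
  fo-tt   : FutureOnly tt
  fo-¬    : ∀ {φ} → FutureOnly φ → FutureOnly (¬' φ)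
  fo-∧    : ∀ {φ ψ} → FutureOnly φ → FutureOnly ψ → FutureOnly (φ ∧' ψ)
  fo-U    : ∀ {I φ ψ} → FutureOnly φ → FutureOnly ψ → FutureOnly (U' I φ ψ)

data PropsIn (Δ : List Prop) : Form → Set where
  pi-prop : ∀ {p} → p ∈ Δ → PropsIn Δ (prop p)
  pi-tt   : PropsIn Δ tt
  pi-¬    : ∀ {φ} → PropsIn Δ φ → PropsIn Δ (¬' φ)
  pi-∧    : ∀ {φ ψ} → PropsIn Δ φ → PropsIn Δ ψ → PropsIn Δ (φ ∧' ψ)
  pi-U    : ∀ {I φ ψ} → PropsIn Δ φ → PropsIn Δ ψ → PropsIn Δ (U' I φ ψ)
  pi-S    : ∀ {I φ ψ} → PropsIn Δ φ → PropsIn Δ ψ → PropsIn Δ (S' I φ ψ)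

-- Finite timed words (positions 0 .. len-1; values beyond len irrelevant)

record TimedWord : Set where
  constructor tw
  field
    len : ℕ
    σ   : ℕ → List Prop
    τ   : ℕ → ℚ

open TimedWord public

IsTimedWordOver : List Prop → TimedWord → Set
IsTimedWordOver Δ ρ =
  (∀ i → i ℕ.< len ρ → (∃[ p ] p ∈ σ ρ i) × (∀ p → p ∈ σ ρ i → p ∈ Δ))
  × (∀ i → i ℕ.< len ρ → 0ℚ ℚ.≤ τ ρ i)
  × (∀ i → suc i ℕ.< len ρ → τ ρ i ℚ.≤ τ ρ (suc i))

Intersects : List Prop → List Prop → Set
Intersects A B = ∃[ p ] (p ∈ A × p ∈ B)

Oversampled : List Prop → List Prop → TimedWord → Set
Oversampled Sig W ρ =
  IsTimedWordOver (Sig ++ W) ρ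
  × (Σ (0 ℕ.< len ρ) λ _ →
       Intersects (σ ρ 0) Sig × Intersects (σ ρ (len ρ ℕ.∸ 1)) Sig)

_at_⊨_ : TimedWord → ℕ → Form → Set
ρ at i ⊨ prop p    = p ∈ σ ρ i
ρ at i ⊨ tt        = ⊤
ρ at i ⊨ (¬' φ)    = ¬ (ρ at i ⊨ φ)
ρ at i ⊨ (φ ∧' ψ)  = (ρ at i ⊨ φ) × (ρ at i ⊨ ψ)
ρ at i ⊨ U' I φ ψ  = ∃[ j ] (i ℕ.< j × j ℕ.< len ρ × (τ ρ j ℚ.- τ ρ i) ∈I I
                          × (ρ at j ⊨ ψ) × (∀ k → i ℕ.< k → k ℕ.< j → ρ at k ⊨ φ))
ρ at i ⊨ S' I φ ψ  = ∃[ j ] (j ℕ.< i × (τ ρ i ℚ.- τ ρ j) ∈I I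
                          × (ρ at j ⊨ ψ) × (∀ k → j ℕ.< k → k ℕ.< i → ρ at k ⊨ φ))

-- ρ ⊨ φ iff ρ at 1 ⊨ φ (first position, index 0 here)
_⊨_ : TimedWord → Form → Set
ρ ⊨ φ = ρ at 0 ⊨ φ

elemᵇ : Prop → List Prop → Bool
elemᵇ p []       = false
elemᵇ p (q ∷ qs) = if p ℕ.≡ᵇ q then true else elemᵇ p qs

act : List Prop → Form
act []       = ff
act (p ∷ ps) = prop p ∨' act ps

onf : List Prop → Form → Form
onf Sig (prop p)   = if elemᵇ p Sig then (prop p ∧' act Sig) else prop p
onf Sig tt         = tt
onf Sig (¬' φ)     = ¬' onf Sig φ
onf Sig (φ ∧' ψ)   = onf Sig φ ∧' onf Sig ψ
onf Sig (U' I φ ψ) = U' I (act Sig ⇒' onf Sig φ) (onf Sig ψ ∧' act Sig)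
onf Sig (S' I φ ψ) = S' I (act Sig ⇒' onf Sig φ) (onf Sig ψ ∧' act Sig)

ONF : List Prop → Form → Form
ONF Sig φ = onf Sig φ ∧' (act Sig ∧' (□all ff ⇒' act Sig))

Tform : Prop → Prop → ℕ → Form
Tform a b l = □ʷ (prop b ⇔' ◇⁻ (Il∞ l) (prop a))

Disjoint : List Prop → List Prop → Set
Disjoint A B = ∀ p → p ∈ A → p ∈ B → ⊥

{-# OPTIONS --safe #-}
-- Only action points (those satisfying act) are constrained. ONF_Σ(T) says that act holds at the
-- first point, B fails there, and at every later action point B holds iff an action-a lies at
-- least l time units earlier (bForced and bJustified). "Every action-a forces B" is already a
-- future property (everyAForcesB). Since time stamps are monotone, "every action point with B is
-- justified" only concerns the first action-a: no action point before it or less than l after it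
-- satisfies B, unless no action point satisfies B at all (firstAQuiet). The pointwise semantics
-- is intuitionistic, so the equivalence is argued in the double-negation monad.
module Submission where

open import Defs
open import Data.Nat using (ℕ)
open import Data.List using (List; _++_)
open import Data.List.Membership.Propositional using (_∈_)
open import Data.Product using (∃-syntax; _×_)
open import Function.Bundles using (_⇔_)

open import Data.Bool using (true; false)
open import Data.List using ([]; _∷_)
open import Data.Empty using (⊥-elim)
open import Data.List.Membership.Propositional.Properties using (∈-++⁺ˡ)
open import Data.List.Relation.Unary.Any using (here; there)
open import Data.Maybe using (just)
open import Data.Nat using (zero; suc; _<_; _≤_; _<?_; _≤′_; ≤′-refl; ≤′-step; z≤n; s≤s)
open import Data.Nat.Properties
  using (≤-refl; ≤⇒≤′; <-trans; n<1+n; <⇒≤; <-≤-trans; ≮⇒≥; <-cmp; m<n⇒0<n; m<n⇒m<1+n; m<1+n⇒m<n∨m≡n)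
open import Data.Product using (_,_; proj₁; proj₂)
import Data.Rational as ℚ
import Data.Rational.Properties as ℚ
open import Data.Sum using (_⊎_; inj₁; inj₂)
open import Data.Unit using (⊤; tt)
open import Effect.Monad using (RawMonad)
open import Level using (0ℓ)
open import Function.Bundles using (mk⇔)
open import Relation.Binary using (tri<; tri≈; tri>)
open import Relation.Binary.PropositionalEquality using (refl; subst)
open import Relation.Nullary using (¬_; Dec; yes; no)
open import Relation.Nullary.Decidable using (¬¬-excluded-middle)
open import Relation.Nullary.Negation using (¬¬-Monad; negated-stable; ¬¬-map)

open RawMonad (¬¬-Monad {0ℓ}) using (_>>=_; return)

record IsFutureClosed (P : Form → Set) : Set where
  field
    tt-closed : P tt
    ¬-closed  : ∀ {φ} → P φ → P (¬' φ)
    ∧-closed  : ∀ {φ ψ} → P φ → P ψ → P (φ ∧' ψ)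
    U-closed  : ∀ {I φ ψ} → P φ → P ψ → P (U' I φ ψ)

  ∨-closed : ∀ {φ ψ} → P φ → P ψ → P (φ ∨' ψ)
  ∨-closed Pφ Pψ = ¬-closed (∧-closed (¬-closed Pφ) (¬-closed Pψ))

  ⇒-closed : ∀ {φ ψ} → P φ → P ψ → P (φ ⇒' ψ)
  ⇒-closed Pφ Pψ = ∨-closed (¬-closed Pφ) Pψ

  □-closed : ∀ {I φ} → P φ → P (□ I φ)
  □-closed Pφ = ¬-closed (U-closed tt-closed (¬-closed Pφ))

  module _ {Sig : List Prop} (P-Sig : ∀ {p} → p ∈ Sig → P (prop p)) where

    act-closed : P (act Sig)
    act-closed = go Sig P-Sig
      where
      go : ∀ Δ → (∀ {p} → p ∈ Δ → P (prop p)) → P (act Δ)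
      go []       _   = ¬-closed tt-closed
      go (p ∷ ps) P-Δ = ∨-closed (P-Δ (here refl)) (go ps (λ q∈ps → P-Δ (there q∈ps)))

    onf-prop-closed : ∀ {p} → P (prop p) → P (onf Sig (prop p))
    onf-prop-closed {p} Pp with elemᵇ p Sig
    ... | true  = ∧-closed Pp act-closed
    ... | false = Pp

futureOnly-closed : IsFutureClosed FutureOnly
futureOnly-closed = record { tt-closed = fo-tt ; ¬-closed = fo-¬ ; ∧-closed = fo-∧ ; U-closed = fo-U }

propsIn-closed : ∀ {Δ} → IsFutureClosed (PropsIn Δ)
propsIn-closed = record { tt-closed = pi-tt ; ¬-closed = pi-¬ ; ∧-closed = pi-∧ ; U-closed = pi-U }

-- ρ at i ⊨ (φ ⇒' ψ) and ρ at i ⊨ □ I φ unfold definitionally to Implies and Always (P, Q the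
-- truth sets of φ, ψ and R the positions at an admissible delay). Stated at this level the rules
-- have inferable arguments, which fails through the formulas since the semantics unfolds them.
Implies : Set → Set → Set
Implies P Q = ¬ (¬ ¬ P × ¬ Q)

module _ {P Q : Set} where

  ⇒-intro : (P → ¬ ¬ Q) → Implies P Q
  ⇒-intro f (¬¬p , ¬q) = ¬¬p (λ p → f p ¬q)

  ⇒-elim : Implies P Q → P → ¬ ¬ Q
  ⇒-elim p⇒q p ¬q = p⇒q ((λ ¬p → ¬p p) , ¬q)

  ⇒-const : Q → Implies P Q
  ⇒-const q = ⇒-intro (λ _ → return q)

module Modalities (ρ : TimedWord) where

  Always : ℕ → (ℕ → Set) → (ℕ → Set) → Set
  Always i R P = ¬ (∃[ j ] (i < j × j < len ρ × R j × ¬ P j × (∀ k → i < k → k < j → ⊤)))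

  module _ {i : ℕ} {R P : ℕ → Set} where

    □-intro : (∀ {j} → i < j → j < len ρ → R j → ¬ ¬ P j) → Always i R P
    □-intro f (j , i<j , j<len , Rj , ¬Pj , _) = f i<j j<len Rj ¬Pj

    □-elim : Always i R P → ∀ {j} → i < j → j < len ρ → R j → ¬ ¬ P j
    □-elim □P {j} i<j j<len Rj ¬Pj = □P (j , i<j , j<len , Rj , ¬Pj , λ _ _ _ → tt)

TimeMonotone : TimedWord → Set
TimeMonotone ρ = ∀ {i k} → i ≤ k → k < len ρ → τ ρ i ℚ.≤ τ ρ k

timedWord⇒timeMonotone : ∀ {Δ ρ} → IsTimedWordOver Δ ρ → TimeMonotone ρ
timedWord⇒timeMonotone {ρ = ρ} (_ , _ , step) i≤k = go (≤⇒≤′ i≤k)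
  where
  go : ∀ {i k} → i ≤′ k → k < len ρ → τ ρ i ℚ.≤ τ ρ k
  go ≤′-refl        _     = ℚ.≤-refl
  go (≤′-step i≤′k) k<len = ℚ.≤-trans (go i≤′k (<-trans (n<1+n _) k<len)) (step _ k<len)

module Elapsed (ρ : TimedWord) (mono : TimeMonotone ρ) where

  elapsed-nonneg : ∀ {i k} → i ≤ k → k < len ρ → ℕtoℚ 0 ℚ.≤ τ ρ k ℚ.- τ ρ i
  elapsed-nonneg {i} i≤k k<len =
    subst (ℚ._≤ τ ρ _ ℚ.- τ ρ i) (ℚ.+-inverseʳ (τ ρ i)) (ℚ.+-monoˡ-≤ (ℚ.- τ ρ i) (mono i≤k k<len))

  elapsed-antitone : ∀ k {i m} → i ≤ m → m < len ρ → τ ρ k ℚ.- τ ρ m ℚ.≤ τ ρ k ℚ.- τ ρ i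
  elapsed-antitone k i≤m m<len = ℚ.+-monoʳ-≤ (τ ρ k) (ℚ.neg-antimono-≤ (mono i≤m m<len))

LeastOrNone : (ℕ → Set) → ℕ → Set
LeastOrNone P n = (∀ m → m < n → ¬ P m) ⊎ ∃[ w ] (w < n × P w × (∀ m → m < w → ¬ P m))

¬¬-leastOrNone : (P : ℕ → Set) (n : ℕ) → ¬ ¬ LeastOrNone P n
¬¬-leastOrNone P zero = return (inj₁ (λ _ ()))
¬¬-leastOrNone P (suc n) = do
  below-n ← ¬¬-leastOrNone P n
  P-n?    ← ¬¬-excluded-middle
  return (extend below-n P-n?)
  where
  extend : LeastOrNone P n → Dec (P n) → LeastOrNone P (suc n)
  extend (inj₂ (w , w<n , Pw , least)) _ = inj₂ (w , m<n⇒m<1+n w<n , Pw , least)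
  extend (inj₁ none) (yes Pn) = inj₂ (n , n<1+n n , Pn , none)
  extend (inj₁ none) (no ¬Pn) = inj₁ below
    where
    below : ∀ m → m < suc n → ¬ P m
    below m m<1+n with m<1+n⇒m<n∨m≡n m<1+n
    ... | inj₁ m<n  = none m m<n
    ... | inj₂ refl = ¬Pn

module Construction (Sig : List Prop) (a b : Prop) (l : ℕ) where

  A B noB pastA lateB quietA bJustified bForced everyAForcesB firstAQuiet ψ : Form
  A             = onf Sig (prop a) ∧' act Sig
  B             = onf Sig (prop b)
  noB           = act Sig ⇒' (¬' B)
  pastA         = S' (Il∞ l) (act Sig ⇒' tt) A
  lateB         = □ (Il∞ l) (act Sig ⇒' B)
  quietA        = A ∧' □ (interval 0 true (just l) false) noB
  bJustified    = B ⇒' pastA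
  bForced       = pastA ⇒' B
  everyAForcesB = □ʷ (A ⇒' lateB)
  firstAQuiet   = quietA ∨' (U' I0∞ noB (quietA ∧' noB) ∨' □all noB)
  ψ             = act Sig ∧' ((¬' B) ∧' (everyAForcesB ∧' firstAQuiet))

  ψ-closed : ∀ {P} → IsFutureClosed P → (∀ {p} → p ∈ Sig → P (prop p)) →
             P (prop a) → P (prop b) → P ψ
  ψ-closed {P} P-closed P-Sig Pa Pb =
    ∧-closed P-act (∧-closed (¬-closed P-B) (∧-closed P-everyAForcesB P-firstAQuiet))
    where
    open IsFutureClosed P-closed
    P-act : P (act Sig)
    P-act = act-closed P-Sig
    P-A : P A
    P-A = ∧-closed (onf-prop-closed P-Sig Pa) P-act
    P-B : P B
    P-B = onf-prop-closed P-Sig Pb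
    P-noB : P noB
    P-noB = ⇒-closed P-act (¬-closed P-B)
    P-quietA : P quietA
    P-quietA = ∧-closed P-A (□-closed P-noB)
    P-everyAForcesB : P everyAForcesB
    P-everyAForcesB = ∧-closed P-A⇒lateB (□-closed P-A⇒lateB)
      where
      P-A⇒lateB : P (A ⇒' lateB)
      P-A⇒lateB = ⇒-closed P-A (□-closed (⇒-closed P-act P-B))
    P-firstAQuiet : P firstAQuiet
    P-firstAQuiet =
      ∨-closed P-quietA (∨-closed (U-closed P-noB (∧-closed P-quietA P-noB)) (□-closed P-noB))

  module Semantics (ρ : TimedWord) (mono : TimeMonotone ρ) where

    infix 4 _⊩_
    _⊩_ : ℕ → Form → Set
    i ⊩ φ = ρ at i ⊨ φ

    open Modalities ρ
    open Elapsed ρ mono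

    AtActionPoints : Form → Set
    AtActionPoints φ = ∀ {j} → 0 < j → j < len ρ → j ⊩ act Sig → j ⊩ φ

    no-pastA-at-0 : ¬ (0 ⊩ pastA)
    no-pastA-at-0 (_ , () , _)

    pastA-intro : ∀ {m j} → m < j → ℕtoℚ l ℚ.≤ τ ρ j ℚ.- τ ρ m → m ⊩ A → j ⊩ pastA
    pastA-intro m<j late Am = _ , m<j , (late , tt) , Am , λ _ _ _ → ⇒-const tt

    noB-refutes : ∀ {j} → j ⊩ noB → j ⊩ act Sig → ¬ (j ⊩ B)
    noB-refutes noBj actj Bj = ⇒-elim noBj actj (λ ¬Bj → ¬Bj Bj)

    everyAForcesB⇒bForced : 0 ⊩ everyAForcesB → AtActionPoints bForced
    everyAForcesB⇒bForced (forces₀ , □forces) {j} _ j<len actj =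
      ⇒-intro λ (m , m<j , (late , _) , Am , _) → do
        lateBm ← ⇒-elim (forcesAt m (<-trans m<j j<len)) Am
        act⇒Bj ← □-elim lateBm m<j j<len (late , tt)
        ⇒-elim act⇒Bj actj
      where
      forcesAt : ∀ m → m < len ρ → m ⊩ (A ⇒' lateB)
      forcesAt zero    _     = forces₀
      forcesAt (suc m) m<len =
        negated-stable (□-elim □forces (s≤s z≤n) m<len (elapsed-nonneg z≤n m<len , tt))

    bForced⇒everyAForcesB : AtActionPoints bForced → 0 ⊩ everyAForcesB
    bForced⇒everyAForcesB forced = forcesAt 0 , □-intro (λ {m} _ _ _ → return (forcesAt m))
      where
      forcesAt : ∀ m → m ⊩ (A ⇒' lateB)
      forcesAt m = ⇒-intro λ Am →
        return (□-intro λ m<j j<len (late , _) →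
        return (⇒-intro λ actj →
          ⇒-elim (forced (m<n⇒0<n m<j) j<len actj) (pastA-intro m<j late Am)))

    quietA-justifies : ∀ {w j} → w ⊩ quietA → w < j → j < len ρ → j ⊩ act Sig → j ⊩ B →
                       ¬ ¬ (j ⊩ pastA)
    quietA-justifies {w} {j} (Aw , □noB) w<j j<len actj Bj ¬pastAj
      with τ ρ j ℚ.- τ ρ w ℚ.<? ℕtoℚ l
    ... | yes early = □-elim □noB w<j j<len (elapsed-nonneg (<⇒≤ w<j) j<len , early)
                        (λ noBj → noB-refutes noBj actj Bj)
    ... | no ¬early = ¬pastAj (pastA-intro w<j (ℚ.≮⇒≥ ¬early) Aw)

    firstAQuiet⇒bJustified : 0 ⊩ firstAQuiet → AtActionPoints bJustified
    firstAQuiet⇒bJustified quiet {j} 0<j j<len actj = ⇒-intro λ Bj ¬pastAj →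
      quiet ( (λ quiet₀ → quietA-justifies quiet₀ 0<j j<len actj Bj ¬pastAj)
            , (λ rest → rest (¬quietLater Bj ¬pastAj , ¬alwaysNoB Bj)))
      where
      ¬quietLater : j ⊩ B → ¬ (j ⊩ pastA) → ¬ (0 ⊩ U' I0∞ noB (quietA ∧' noB))
      ¬quietLater Bj ¬pastAj (w , _ , w<len , _ , (quietA-w , noB-w) , noB-before) with <-cmp j w
      ... | tri< j<w _ _  = noB-refutes (noB-before j 0<j j<w) actj Bj
      ... | tri≈ _ refl _ = noB-refutes noB-w actj Bj
      ... | tri> _ _ w<j  = quietA-justifies quietA-w w<j j<len actj Bj ¬pastAj
      ¬alwaysNoB : j ⊩ B → ¬ (0 ⊩ □all noB)
      ¬alwaysNoB Bj □noB = □-elim □noB 0<j j<len (elapsed-nonneg z≤n j<len , tt)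
                             (λ noBj → noB-refutes noBj actj Bj)

    module _ (justified : AtActionPoints bJustified) where

      noB-before-A : ∀ {w k} → (∀ m → m < w → ¬ (m ⊩ A)) → 0 < k → k ≤ w → k < len ρ → k ⊩ noB
      noB-before-A noA 0<k k≤w k<len = ⇒-intro λ actk → return λ Bk →
        ⇒-elim (justified 0<k k<len actk) Bk λ (m , m<k , _ , Am , _) → noA m (<-≤-trans m<k k≤w) Am

      leastA-quiet : ∀ {w} → w ⊩ A → (∀ m → m < w → ¬ (m ⊩ A)) → w ⊩ quietA
      leastA-quiet {w} Aw least = Aw , □-intro λ {k} w<k k<len (_ , early) →
        return (⇒-intro λ actk → return λ Bk →
          ⇒-elim (justified (m<n⇒0<n w<k) k<len actk) Bk λ (m , m<k , (late , _) , Am , _) →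
            notLate m<k k<len late early Am)
        where
        notLate : ∀ {m k} → m < k → k < len ρ → ℕtoℚ l ℚ.≤ τ ρ k ℚ.- τ ρ m →
                  τ ρ k ℚ.- τ ρ w ℚ.< ℕtoℚ l → ¬ (m ⊩ A)
        notLate {m} {k} m<k k<len late early Am with m <? w
        ... | yes m<w = least m m<w Am
        ... | no  m≮w = ℚ.<-irrefl refl (ℚ.≤-<-trans (ℚ.≤-trans late w-earlier) early)
          where
          w-earlier : τ ρ k ℚ.- τ ρ m ℚ.≤ τ ρ k ℚ.- τ ρ w
          w-earlier = elapsed-antitone k (≮⇒≥ m≮w) (<-trans m<k k<len)

      bJustified⇒firstAQuiet : 0 ⊩ firstAQuiet
      bJustified⇒firstAQuiet (¬quietA₀ , ¬rest) = ¬¬-leastOrNone (_⊩ A) (len ρ) λ where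
        (inj₁ noA) → ¬rest λ (_ , ¬alwaysNoB) → ¬alwaysNoB (□-intro λ 0<k k<len _ →
          return (noB-before-A noA 0<k (<⇒≤ k<len) k<len))
        (inj₂ (zero , _ , A₀ , least)) → ¬quietA₀ (leastA-quiet A₀ least)
        (inj₂ (suc w , w<len , Aw , least)) → ¬rest λ (¬quietLater , _) → ¬quietLater
          ( suc w , s≤s z≤n , w<len , (elapsed-nonneg z≤n w<len , tt)
          , (leastA-quiet Aw least , noB-before-A least (s≤s z≤n) ≤-refl w<len)
          , λ k 0<k k<w → noB-before-A least 0<k (<⇒≤ k<w) (<-trans k<w w<len))

    ONF-intro : 0 ⊩ act Sig → ¬ (0 ⊩ B) → AtActionPoints (bJustified ∧' bForced) →
                0 ⊩ ONF Sig (Tform a b l)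
    ONF-intro act₀ ¬B₀ agree = ((agree₀ , noDisagreement) , act₀ , ⇒-const act₀)
      where
      agree₀ : 0 ⊩ (bJustified ∧' bForced)
      agree₀ = ⇒-intro (λ B₀ → ⊥-elim (¬B₀ B₀)) , ⇒-intro (λ pastA₀ → ⊥-elim (no-pastA-at-0 pastA₀))
      noDisagreement : ¬ (0 ⊩ U' I0∞ (act Sig ⇒' tt) ((¬' (bJustified ∧' bForced)) ∧' act Sig))
      noDisagreement (j , 0<j , j<len , _ , (¬agree , actj) , _) = ¬agree (agree 0<j j<len actj)

    ONF-elim : 0 ⊩ ONF Sig (Tform a b l) →
               0 ⊩ act Sig × ¬ (0 ⊩ B) × AtActionPoints (bJustified ∧' bForced)
    ONF-elim ((agree₀ , noDisagreement) , act₀ , _) = act₀ , ¬B₀ , agree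
      where
      ¬B₀ : ¬ (0 ⊩ B)
      ¬B₀ B₀ = ⇒-elim (proj₁ agree₀) B₀ no-pastA-at-0
      agree : AtActionPoints (bJustified ∧' bForced)
      agree {j} 0<j j<len actj = stable (λ ¬agree → noDisagreement
        (j , 0<j , j<len , (elapsed-nonneg z≤n j<len , tt) , (¬agree , actj) , λ _ _ _ → ⇒-const tt))
        where
        stable : ¬ ¬ (j ⊩ (bJustified ∧' bForced)) → j ⊩ (bJustified ∧' bForced)
        stable ¬¬agree = negated-stable (¬¬-map proj₁ ¬¬agree) , negated-stable (¬¬-map proj₂ ¬¬agree)

    ψ⇔ONF : (0 ⊩ ψ) ⇔ (0 ⊩ ONF Sig (Tform a b l))
    ψ⇔ONF = mk⇔ to from
      where
      to : 0 ⊩ ψ → 0 ⊩ ONF Sig (Tform a b l)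
      to (act₀ , ¬B₀ , forces , quiet) = ONF-intro act₀ ¬B₀ λ 0<j j<len actj →
        firstAQuiet⇒bJustified quiet 0<j j<len actj , everyAForcesB⇒bForced forces 0<j j<len actj
      from : 0 ⊩ ONF Sig (Tform a b l) → 0 ⊩ ψ
      from onf₀ with ONF-elim onf₀
      ... | act₀ , ¬B₀ , agree =
        act₀ , ¬B₀ , bForced⇒everyAForcesB (λ 0<j j<len actj → proj₂ (agree 0<j j<len actj))
                   , bJustified⇒firstAQuiet (λ 0<j j<len actj → proj₁ (agree 0<j j<len actj))

lemma7 : (Sig W : List Prop) → Disjoint Sig W →
    (a b : Prop) → a ∈ Sig ++ W → b ∈ Sig ++ W → (l : ℕ) →
    ∃[ ψ ] (FutureOnly ψ × PropsIn (Sig ++ W) ψ ×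
    (∀ ρ → Oversampled Sig W ρ →
    (ρ ⊨ ψ) ⇔ (ρ ⊨ ONF Sig (Tform a b l))))
lemma7 Sig W _ a b a∈ b∈ l =
  ψ , ψ-closed futureOnly-closed (λ {p} _ → fo-prop p) (fo-prop a) (fo-prop b)
    , ψ-closed propsIn-closed (λ p∈Sig → pi-prop (∈-++⁺ˡ p∈Sig)) (pi-prop a∈) (pi-prop b∈)
    , λ ρ (timedWord , _) → Semantics.ψ⇔ONF ρ (timedWord⇒timeMonotone timedWord)
  where open Construction Sig a b l
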